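{- For every integer $n\geq 2$, the $n$-book graph $B_n$ satisfies $\lceil\sqrt{n}\,\rceil<\chi_D(B_n)$.
   Context: The $n$-book graph $B_n$ ($n\geq 2$) is the Cartesian product of the star $K_{1,n}$ and the path $P_2$ on two vertices; concretely it has vertices $v_0,w_0,v_1,w_1,\dots,v_n,w_n$ and edges $v_0w_0$, $v_0v_i$, $w_0w_i$, $v_iw_i$ for $1\leq i\leq n$. A vertex coloring is distinguishing if the only automorphism preserving all vertex colors is the identity. The distinguishing chromatic number $\chi_D(G)$ is the minimum $r$ such that $G$ has a proper distinguishing coloring with $r$ colors. -}

module Defs where

open import Data.Nat using (ℕ; suc; _≤_; _*_)
open import Data.Fin using (Fin; zero)
open import Data.Product using (_×_; _,_)
open import Data.Sum using (_⊎_)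
open import Relation.Binary.PropositionalEquality using (_≡_; _≢_)
open import Function.Bundles using (_⇔_)

-- Vertices of the n-book graph B_n: (zero , i) is v_i and (suc zero , i) is w_i,
-- for i ∈ {0,…,n}.
V : ℕ → Set
V n = Fin 2 × Fin (suc n)

-- Adjacency of B_n = K_{1,n} □ P_2:
--   v_i w_i (same index, different layer), and
--   v_0 v_i, w_0 w_i for i ≥ 1 (same layer, exactly one index is 0).
Adj : (n : ℕ) → V n → V n → Set
Adj n (a , i) (b , j) =
  (a ≢ b × i ≡ j)
  ⊎ (a ≡ b × ((i ≡ zero × j ≢ zero) ⊎ (i ≢ zero × j ≡ zero)))

record Automorphism (n : ℕ) : Set where
  field
    f   : V n → V n
    g   : V n → V n
    gf  : ∀ u → g (f u) ≡ u
    fg  : ∀ u → f (g u) ≡ u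
    adj : ∀ u v → Adj n u v ⇔ Adj n (f u) (f v)

Proper : (n r : ℕ) → (V n → Fin r) → Set
Proper n r c = ∀ u v → Adj n u v → c u ≢ c v

Distinguishing : (n r : ℕ) → (V n → Fin r) → Set
Distinguishing n r c =
  (σ : Automorphism n) → (∀ u → c (Automorphism.f σ u) ≡ c u) →
  ∀ u → Automorphism.f σ u ≡ u

IsCeilSqrt : ℕ → ℕ → Set
IsCeilSqrt n k = (n ≤ k * k) × (∀ j → n ≤ j * j → k ≤ j)

{-# OPTIONS --safe #-}
module Submission where

-- Swapping two pages {v_x, w_x} and {v_y, w_y} with x, y ≥ 1 is an automorphism of B_n,
-- so a distinguishing coloring gives distinct pages distinct color pairs
-- (c v_x , c w_x). A proper coloring makes these pairs avoid c v_0 in the first and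
-- c w_0 in the second coordinate, so with r colors there are at most (r - 1)² pages:
-- n ≤ (r - 1)², hence ⌈√n⌉ ≤ r - 1.

open import Defs
open import Data.Nat using (ℕ; zero; suc; _≤_; _<_; s≤s; _*_)
open import Data.Fin using (Fin; zero; suc; punchOut; combine; _≟_)
open import Data.Fin.Properties
  using (¬Fin0; suc-injective; punchOut-injective; combine-injective; injective⇒≤)
open import Data.Fin.Permutation using (Permutation′; _⟨$⟩ʳ_; inverseˡ; flip; lift₀; transpose)
import Data.Fin.Permutation.Components as PC
open import Data.Product using (_×_; _,_; proj₁; proj₂; map₂)
open import Data.Product.Properties using (×-≡,≡→≡)
open import Data.Product.Function.NonDependent.Propositional using (_×-⇔_)
open import Data.Sum using (inj₁; inj₂)
open import Data.Sum.Function.Propositional using (_⊎-⇔_)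
open import Data.Empty using (⊥-elim)
open import Relation.Nullary using (yes; no)
open import Function.Bundles using (_⇔_; mk⇔; Injection)
open import Function.Construct.Identity using (⇔-id)
open import Function.Definitions using (Injective)
open import Function.Properties.Inverse using (↔⇒↣)
open import Function.Related.TypeIsomorphisms using (¬-cong-⇔)
open import Relation.Binary.PropositionalEquality
  using (_≡_; _≢_; refl; sym; cong; module ≡-Reasoning)

private
  variable
    n m r : ℕ
    A : Set

Adj-cong : {a b : Fin 2} {i j i′ j′ : Fin (suc n)} →
           (i ≡ j ⇔ i′ ≡ j′) → (i ≡ zero ⇔ i′ ≡ zero) → (j ≡ zero ⇔ j′ ≡ zero) →
           Adj n (a , i) (b , j) ⇔ Adj n (a , i′) (b , j′)
Adj-cong i≡j i≡0 j≡0 =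
  (⇔-id _ ×-⇔ i≡j) ⊎-⇔
  (⇔-id _ ×-⇔ ((i≡0 ×-⇔ ¬-cong-⇔ j≡0) ⊎-⇔ (¬-cong-⇔ i≡0 ×-⇔ j≡0)))

spine-Adj : (a : Fin 2) (x : Fin n) → Adj n (a , zero) (a , suc x)
spine-Adj a x = inj₂ (refl , inj₁ (refl , λ ()))

lift₀-≡zero : (π : Permutation′ n) (i : Fin (suc n)) → i ≡ zero ⇔ lift₀ π ⟨$⟩ʳ i ≡ zero
lift₀-≡zero π zero    = mk⇔ (λ _ → refl) (λ _ → refl)
lift₀-≡zero π (suc i) = mk⇔ (λ ()) (λ ())

permute-≡ : (π : Permutation′ n) {i j : Fin n} → i ≡ j ⇔ π ⟨$⟩ʳ i ≡ π ⟨$⟩ʳ j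
permute-≡ π = mk⇔ (cong (π ⟨$⟩ʳ_)) (Injection.injective (↔⇒↣ π))

permutePages : Permutation′ n → V n → V n
permutePages π = map₂ (lift₀ π ⟨$⟩ʳ_)

permutePages-Adj : (π : Permutation′ n) (u v : V n) →
                   Adj n u v ⇔ Adj n (permutePages π u) (permutePages π v)
permutePages-Adj π (a , i) (b , j) =
  Adj-cong (permute-≡ (lift₀ π)) (lift₀-≡zero π i) (lift₀-≡zero π j)

permutePages-inverse : (π : Permutation′ n) (u : V n) →
                       permutePages (flip π) (permutePages π u) ≡ u
permutePages-inverse π (a , zero)  = refl
permutePages-inverse π (a , suc i) = cong (λ j → a , suc j) (inverseˡ π)

pageAutomorphism : Permutation′ n → Automorphism n
pageAutomorphism π = record
  { f   = permutePages π
  ; g   = permutePages (flip π)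
  ; gf  = permutePages-inverse π
  ; fg  = permutePages-inverse (flip π)
  ; adj = permutePages-Adj π
  }

transpose-matchˡ : (x y : Fin n) → PC.transpose x y x ≡ y
transpose-matchˡ x y with x ≟ x
... | yes _ = refl
... | no x≢x = ⊥-elim (x≢x refl)

transpose-preserves : (f : Fin n → A) {x y : Fin n} → f x ≡ f y →
                      ∀ k → f (PC.transpose x y k) ≡ f k
transpose-preserves f {x} {y} fx≡fy k with k ≟ x
... | yes refl = sym fx≡fy
... | no _ with k ≟ y
...   | yes refl = fx≡fy
...   | no _ = refl

pageColors : (V n → Fin r) → Fin n → Fin r × Fin r
pageColors c x = c (zero , suc x) , c (suc zero , suc x)

pageSwap-preserves : (c : V n → Fin r) {x y : Fin n} → pageColors c x ≡ pageColors c y →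
                     ∀ u → c (permutePages (transpose x y) u) ≡ c u
pageSwap-preserves c e (a , zero)         = refl
pageSwap-preserves c e (zero , suc k)     =
  transpose-preserves (λ i → c (zero , suc i)) (cong proj₁ e) k
pageSwap-preserves c e (suc zero , suc k) =
  transpose-preserves (λ i → c (suc zero , suc i)) (cong proj₂ e) k

distinguishing⇒pageColors-injective : {c : V n → Fin r} → Distinguishing n r c →
                                      Injective _≡_ _≡_ (pageColors c)
distinguishing⇒pageColors-injective {c = c} distinguishing {x} {y} e = begin
  x                     ≡⟨ suc-injective (cong proj₂ v_x-fixed) ⟨
  PC.transpose x y x    ≡⟨ transpose-matchˡ x y ⟩
  y                     ∎
  where
  open ≡-Reasoning
  v_x-fixed : (zero , suc (PC.transpose x y x)) ≡ (zero , suc x)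
  v_x-fixed = distinguishing (pageAutomorphism (transpose x y)) (pageSwap-preserves c e) (zero , suc x)

injective-avoiding⇒≤ : {n m : ℕ} {a b : Fin (suc m)} (p : Fin n → Fin (suc m) × Fin (suc m)) →
                       Injective _≡_ _≡_ p →
                       (∀ x → a ≢ proj₁ (p x)) → (∀ x → b ≢ proj₂ (p x)) → n ≤ m * m
injective-avoiding⇒≤ {n} {m} p p-injective a≢ b≢ = injective⇒≤ {f = code} code-injective
  where
  code : Fin n → Fin (m * m)
  code x = combine (punchOut (a≢ x)) (punchOut (b≢ x))
  code-injective : Injective _≡_ _≡_ code
  code-injective {x} {y} e = p-injective (×-≡,≡→≡
    ( punchOut-injective (a≢ x) (a≢ y) (proj₁ halves)
    , punchOut-injective (b≢ x) (b≢ y) (proj₂ halves)))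
    where
    halves : punchOut (a≢ x) ≡ punchOut (a≢ y) × punchOut (b≢ x) ≡ punchOut (b≢ y)
    halves = combine-injective _ _ _ _ e

proper-distinguishing⇒≤ : {c : V n → Fin (suc m)} →
                          Proper n (suc m) c → Distinguishing n (suc m) c → n ≤ m * m
proper-distinguishing⇒≤ {c = c} proper distinguishing =
  injective-avoiding⇒≤ (pageColors c) (distinguishing⇒pageColors-injective distinguishing)
    (λ x → proper _ _ (spine-Adj zero x)) (λ x → proper _ _ (spine-Adj (suc zero) x))

lemma5p8 : (n : ℕ) → 2 ≤ n → (k : ℕ) → IsCeilSqrt n k →
    (r : ℕ) → (c : V n → Fin r) → Proper n r c → Distinguishing n r c → k < r
lemma5p8 n _ k _           zero    c _      _              = ⊥-elim (¬Fin0 (c (zero , zero)))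
lemma5p8 n _ k (_ , least) (suc m) c proper distinguishing =
  s≤s (least m (proper-distinguishing⇒≤ proper distinguishing))
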